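{- Let $X$ be an orientable map whose transition matrix satisfies $U^2=I$, and let $u,v$ be distinct vertices of $X$ of equal degree. Then there is perfect state transfer from $u$ to $v$ at time $1$ if and only if $V=\{u,v\}$.
   Context: An orientable map $X$ is a 2-cell embedding of a finite connected multigraph (loops and parallel edges allowed) in a closed orientable surface, with vertex set $V$ and face set $F$. Each edge gives two arcs on opposite sides of it, pointing in opposite directions, each lying in a face and oriented along its clockwise facial walk. Let $\mathcal A$ be the set of arcs, $v(a)$ the tail vertex and $f(a)$ the face of arc $a$; $N\in\{0,1\}^{\mathcal A\times V}$ with $N(a,w)=1$ iff $w=v(a)$; $M\in\{0,1\}^{\mathcal A\times F}$ with $M(a,f)=1$ iff $f=f(a)$; $D=N^TN$, $\Delta=M^TM$; $\hat N=ND^{ -1/2}$, $\hat M=M\Delta^{ -1/2}$, $Q=\hat N\hat N^T$, $P=\hat M\hat M^T$; the transition matrix is $U=(2P-I)(2Q-I)$. There is perfect state transfer from $u$ to $v$ at time $\tau$ if $U^\tau\hat Ne_u=\hat Ne_v$, where $e_w$ is the standard basis vector of $\mathbb{C}^V$. -}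

module Defs where

open import Data.Nat using (ℕ; zero; suc)
open import Data.Fin using (Fin; _≟_)
open import Data.Bool using (if_then_else_)
open import Data.Product using (Σ; ∃; _×_)
open import Relation.Nullary using (¬_)
open import Relation.Nullary.Decidable using (⌊_⌋)
open import Relation.Binary.PropositionalEquality using (_≡_)
open import Data.Rational using (ℚ; 0ℚ; 1ℚ; _+_; _*_; _-_; _≤_; _/_)
open import Data.Integer using (+_)

iter : ∀ {n} → (Fin n → Fin n) → ℕ → Fin n → Fin n
iter f zero    a = a
iter f (suc k) a = f (iter f k a)

SameOrbit : ∀ {n} → (Fin n → Fin n) → Fin n → Fin n → Set
SameOrbit f a b = ∃ λ k → iter f k a ≡ b

-- reachability using the generators σ, θ (finite permutations, so
-- forward steps suffice for the generated group)
data Reach {n} (σ θ : Fin n → Fin n) (a : Fin n) : Fin n → Set where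
  here  : Reach σ θ a a
  stepσ : ∀ {b} → Reach σ θ a b → Reach σ θ a (σ b)
  stepθ : ∀ {b} → Reach σ θ a b → Reach σ θ a (θ b)

-- Orientable maps as rotation systems on the set of arcs.
-- Arcs: Fin nA.  θ: the arc on the other side of the same edge
-- (fixed-point-free involution).  σ: rotation of arcs around their tail
-- vertex.  Face permutation φ = σ ∘ θ (next arc along the facial walk).
-- Vertices (Fin nV) label the σ-cycles, faces (Fin nF) the φ-cycles.

record OrientableMap : Set where
  field
    nA nV nF : ℕ
    σ σ⁻ θ   : Fin nA → Fin nA
    σσ⁻      : ∀ a → σ (σ⁻ a) ≡ a
    σ⁻σ      : ∀ a → σ⁻ (σ a) ≡ a
    θθ       : ∀ a → θ (θ a) ≡ a
    θ-fpf    : ∀ a → ¬ (θ a ≡ a)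
    connected : ∀ a b → Reach σ θ a b
    tail     : Fin nA → Fin nV
    face     : Fin nA → Fin nF
    tail-surj : ∀ w → ∃ λ a → tail a ≡ w
    face-surj : ∀ f → ∃ λ a → face a ≡ f
    tail-orbit₁ : ∀ a b → tail a ≡ tail b → SameOrbit σ a b
    tail-orbit₂ : ∀ a b → SameOrbit σ a b → tail a ≡ tail b
    face-orbit₁ : ∀ a b → face a ≡ face b → SameOrbit (λ x → σ (θ x)) a b
    face-orbit₂ : ∀ a b → SameOrbit (λ x → σ (θ x)) a b → face a ≡ face b

sumFin : ∀ n → (Fin n → ℚ) → ℚ
sumFin zero    f = 0ℚ
sumFin (suc n) f = f Fin.zero + sumFin n (λ i → f (Fin.suc i))

[_≟_]ℚ : ∀ {n} → Fin n → Fin n → ℚ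
[ a ≟ b ]ℚ = if ⌊ a ≟ b ⌋ then 1ℚ else 0ℚ

ℕtoℚ : ℕ → ℚ
ℕtoℚ k = + k / 1

-- 1/k for k > 0 (only ever applied to positive k below: the degree of
-- the tail of an existing arc, the length of the face of an existing arc)
recipℕ : ℕ → ℚ
recipℕ zero    = 0ℚ
recipℕ (suc k) = + 1 / suc k

Mat : ℕ → Set
Mat n = Fin n → Fin n → ℚ

_⊗_ : ∀ {n} → Mat n → Mat n → Mat n
_⊗_ {n} A B i j = sumFin n (λ k → A i k * B k j)

idM : ∀ {n} → Mat n
idM i j = [ i ≟ j ]ℚ

powM : ∀ {n} → Mat n → ℕ → Mat n
powM A zero    = idM
powM A (suc k) = A ⊗ powM A k

module _ (X : OrientableMap) where
  open OrientableMap X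

  deg : Fin nV → ℕ
  deg w = sumℕ nA (λ a → if ⌊ tail a ≟ w ⌋ then 1 else 0)
    where
    sumℕ : ∀ n → (Fin n → ℕ) → ℕ
    sumℕ zero    g = 0
    sumℕ (suc n) g = g Fin.zero Data.Nat.+ sumℕ n (λ i → g (Fin.suc i))

  flen : Fin nF → ℕ
  flen f = sumℕ nA (λ a → if ⌊ face a ≟ f ⌋ then 1 else 0)
    where
    sumℕ : ∀ n → (Fin n → ℕ) → ℕ
    sumℕ zero    g = 0
    sumℕ (suc n) g = g Fin.zero Data.Nat.+ sumℕ n (λ i → g (Fin.suc i))

  -- Q = N D⁻¹ Nᵀ  : Q(a,b) = [v(a)=v(b)] / deg v(a)
  Qm : Mat nA
  Qm a b = if ⌊ tail a ≟ tail b ⌋ then recipℕ (deg (tail a)) else 0ℚ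

  -- P = M Δ⁻¹ Mᵀ  : P(a,b) = [f(a)=f(b)] / |f(a)|
  Pm : Mat nA
  Pm a b = if ⌊ face a ≟ face b ⌋ then recipℕ (flen (face a)) else 0ℚ

  twoMinusI : Mat nA → Mat nA
  twoMinusI A i j = ℕtoℚ 2 * A i j - idM i j

  U : Mat nA
  U = twoMinusI Pm ⊗ twoMinusI Qm

  Ne : Fin nV → Fin nA → ℚ
  Ne w a = [ tail a ≟ w ]ℚ

  UτNe : ℕ → Fin nV → Fin nA → ℚ
  UτNe τ u a = sumFin nA (λ b → powM U τ a b * Ne u b)

-- "x / √p = y / √q" for rationals x, y and positive naturals p, q,
-- written without square roots: (x/√p = y/√q) ⇔ x²q = y²p ∧ xy ≥ 0.
SqrtScaledEq : ℚ → ℕ → ℚ → ℕ → Set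
SqrtScaledEq x p y q = (x * x * ℕtoℚ q ≡ y * y * ℕtoℚ p) × (0ℚ ≤ x * y)

-- Perfect state transfer from u to v at time τ:
--   U^τ N̂ e_u = N̂ e_v, where N̂ e_w = (N e_w) / √deg w.
PST : (X : OrientableMap) → ℕ → Fin (OrientableMap.nV X) → Fin (OrientableMap.nV X) → Set
PST X τ u v = ∀ a → SqrtScaledEq (UτNe X τ u a) (deg X u) (Ne X v a) (deg X v)

{-# OPTIONS --safe #-}
module Submission where

-- Write x_w for the indicator of the arcs with tail w.  P and Q average a
-- function over the faces, resp. the vertices, of the arcs, so Q x_w = x_w and
-- U x_u = (2P − I) x_u; as deg u = deg v, transfer at time 1 means U x_u = x_v.
-- If it holds, x_u + x_v = 2 P x_u is constant on faces and on vertices, hence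
-- on all arcs of the connected map, and it is 1 on the arcs at u: every vertex
-- is u or v.  Conversely, if V = {u, v} then x_u + x_v = 1.  Both 2P − I and
-- 2Q − I are involutions, so U² = I turns into (2Q − I)(2P − I) x_u =
-- (2P − I) x_u, which makes p = P x_u invariant under Q as well as P, hence
-- constant; counting arcs gives p = 1/2, i.e. U x_u = 1 − x_u = x_v.

open import Defs
open import Data.Nat as ℕ using (ℕ; zero; suc; NonZero)
import Data.Nat.Properties as ℕP
open import Data.Fin using (Fin; _≟_) renaming (zero to fzero; suc to fsuc)
open import Data.Bool using (true; false; if_then_else_)
open import Data.Product using (_×_; _,_)
open import Data.Sum using (_⊎_; inj₁; inj₂)
open import Data.Empty using (⊥-elim)
open import Function.Base using (_on_; _∘_)
open import Relation.Binary.Core using (_Preserves_⟶_)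
open import Relation.Binary.PropositionalEquality
open import Relation.Nullary using (¬_; yes; no)
open import Relation.Nullary.Decidable using (⌊_⌋; ⌊⌋-map′)
open import Algebra.Bundles using (CommutativeRing)
import Data.Integer as ℤ
import Data.Integer.Tactic.RingSolver as ℤSolver
open import Data.Rational using (ℚ; 0ℚ; 1ℚ; _+_; _*_; _-_; -_; _≤_; 1/_; toℚᵘ; ≢-nonZero)
import Data.Rational.Properties as ℚP
import Data.Rational.Unnormalised as ℚᵘ
import Data.Rational.Unnormalised.Properties as ℚᵘP
open import Data.Rational.Solver using (module +-*-Solver)
open +-*-Solver using (solve; _:+_; _:*_; _:-_; :-_; con; _:=_)
open import Algebra.Properties.Semiring.Sum (CommutativeRing.semiring ℚP.+-*-commutativeRing)
  using (sum; sum-cong-≗; ∑-distrib-+; ∑-comm; *-distribˡ-sum; *-distribʳ-sum)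
import Algebra.Properties.Monoid.Sum ℕP.+-0-monoid as ℕΣ

*-cancelʳ-≡ : ∀ {p q r} → r ≢ 0ℚ → p * r ≡ q * r → p ≡ q
*-cancelʳ-≡ {p} {q} {r} r≢0 pr≡qr =
  trans (sym (divide p)) (trans (cong (_* 1/ r) pr≡qr) (divide q))
  where
  instance _ = ≢-nonZero r≢0
  divide : ∀ x → x * r * 1/ r ≡ x
  divide x = trans (ℚP.*-assoc x r (1/ r))
    (trans (cong (x *_) (ℚP.*-inverseʳ r)) (ℚP.*-identityʳ x))

*-cancelˡ-≡ : ∀ {p q r} → r ≢ 0ℚ → r * p ≡ r * q → p ≡ q
*-cancelˡ-≡ {p} {q} {r} r≢0 rp≡rq =
  *-cancelʳ-≡ r≢0 (trans (ℚP.*-comm p r) (trans rp≡rq (ℚP.*-comm r q)))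

2≢0 : ℕtoℚ 2 ≢ 0ℚ
2≢0 ()

p*p≡0⇒p≡0 : ∀ {p} → p * p ≡ 0ℚ → p ≡ 0ℚ
p*p≡0⇒p≡0 {p} pp≡0 with p ℚP.≟ 0ℚ
... | yes p≡0 = p≡0
... | no  p≢0 = *-cancelʳ-≡ p≢0 (trans pp≡0 (sym (ℚP.*-zeroˡ p)))

p*p≡1⇒p≡1 : ∀ {p} → 0ℚ ≤ p → p * p ≡ 1ℚ → p ≡ 1ℚ
p*p≡1⇒p≡1 {p} 0≤p pp≡1 = begin
  p             ≡⟨ solve 1 (λ p → p := (p :- con 1ℚ) :+ con 1ℚ) refl p ⟩
  p - 1ℚ + 1ℚ   ≡⟨ cong (_+ 1ℚ) (*-cancelʳ-≡ {p - 1ℚ} p+1≢0 factorised) ⟩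
  0ℚ + 1ℚ       ≡⟨ ℚP.+-identityˡ 1ℚ ⟩
  1ℚ            ∎
  where
  open ≡-Reasoning
  p+1≢0 : p + 1ℚ ≢ 0ℚ
  p+1≢0 = ≢-sym (ℚP.<⇒≢ (ℚP.+-mono-≤-< 0≤p (ℚP.positive⁻¹ 1ℚ)))
  factorised : (p - 1ℚ) * (p + 1ℚ) ≡ 0ℚ * (p + 1ℚ)
  factorised = begin
    (p - 1ℚ) * (p + 1ℚ)  ≡⟨ solve 1 (λ p → (p :- con 1ℚ) :* (p :+ con 1ℚ) := p :* p :- con 1ℚ) refl p ⟩
    p * p - 1ℚ           ≡⟨ cong (_- 1ℚ) pp≡1 ⟩
    0ℚ                   ≡⟨ sym (ℚP.*-zeroˡ (p + 1ℚ)) ⟩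
    0ℚ * (p + 1ℚ)        ∎

square-root-of-0-or-1 : ∀ {p q} → q ≡ 0ℚ ⊎ q ≡ 1ℚ → p * p ≡ q * q → 0ℚ ≤ p * q → p ≡ q
square-root-of-0-or-1 {p} (inj₁ refl) pp≡qq _    = p*p≡0⇒p≡0 pp≡qq
square-root-of-0-or-1 {p} (inj₂ refl) pp≡qq 0≤pq =
  p*p≡1⇒p≡1 (subst (0ℚ ≤_) (ℚP.*-identityʳ p) 0≤pq) pp≡qq

ℕtoℚ-homo-+ : ∀ m n → ℕtoℚ (m ℕ.+ n) ≡ ℕtoℚ m + ℕtoℚ n
ℕtoℚ-homo-+ m n = ℚP.toℚᵘ-injective (begin
  toℚᵘ (ℕtoℚ (m ℕ.+ n))                    ≈⟨ toℚᵘ-ℕtoℚ (m ℕ.+ n) ⟩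
  ℚᵘ.mkℚᵘ (ℤ.+ m ℤ.+ ℤ.+ n) 0              ≈⟨ ℚᵘ.*≡* (identity (ℤ.+ m) (ℤ.+ n)) ⟩
  ℚᵘ.mkℚᵘ (ℤ.+ m) 0 ℚᵘ.+ ℚᵘ.mkℚᵘ (ℤ.+ n) 0  ≈⟨ ℚᵘP.+-cong (≃-sym (toℚᵘ-ℕtoℚ m)) (≃-sym (toℚᵘ-ℕtoℚ n)) ⟩
  toℚᵘ (ℕtoℚ m) ℚᵘ.+ toℚᵘ (ℕtoℚ n)         ≈⟨ ≃-sym (ℚP.toℚᵘ-homo-+ (ℕtoℚ m) (ℕtoℚ n)) ⟩
  toℚᵘ (ℕtoℚ m + ℕtoℚ n)                   ∎)
  where
  open ℚᵘP.≃-Reasoning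
  open ℚᵘP using (≃-sym)
  toℚᵘ-ℕtoℚ : ∀ k → toℚᵘ (ℕtoℚ k) ℚᵘ.≃ ℚᵘ.mkℚᵘ (ℤ.+ k) 0
  toℚᵘ-ℕtoℚ k = ℚP.toℚᵘ-fromℚᵘ (ℚᵘ.mkℚᵘ (ℤ.+ k) 0)
  identity : ∀ i j → (i ℤ.+ j) ℤ.* ℤ.+ 1 ≡ (i ℤ.* ℤ.+ 1 ℤ.+ j ℤ.* ℤ.+ 1) ℤ.* ℤ.+ 1
  identity = ℤSolver.solve-∀

recipℕ-inverseˡ : ∀ n → .{{NonZero n}} → recipℕ n * ℕtoℚ n ≡ 1ℚ
recipℕ-inverseˡ (suc k) = ℚP.toℚᵘ-injective (begin
  toℚᵘ (recipℕ (suc k) * ℕtoℚ (suc k))         ≈⟨ ℚP.toℚᵘ-homo-* (recipℕ (suc k)) (ℕtoℚ (suc k)) ⟩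
  toℚᵘ (recipℕ (suc k)) ℚᵘ.* toℚᵘ (ℕtoℚ (suc k))
    ≈⟨ ℚᵘP.*-cong (ℚP.toℚᵘ-fromℚᵘ (ℚᵘ.mkℚᵘ (ℤ.+ 1) k)) (ℚP.toℚᵘ-fromℚᵘ (ℚᵘ.mkℚᵘ (ℤ.+ suc k) 0)) ⟩
  ℚᵘ.mkℚᵘ (ℤ.+ 1) k ℚᵘ.* ℚᵘ.mkℚᵘ (ℤ.+ suc k) 0    ≈⟨ ℚᵘ.*≡* (cong ℤ.+_ (ℕP.*-assoc 1 (suc k) 1)) ⟩
  ℚᵘ.1ℚᵘ                                       ∎)
  where open ℚᵘP.≃-Reasoning

ℕtoℚ-nonZero : ∀ n → .{{NonZero n}} → ℕtoℚ n ≢ 0ℚ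
ℕtoℚ-nonZero n n≡0 = ℚP.1≢0 (begin
  1ℚ                    ≡⟨ sym (recipℕ-inverseˡ n) ⟩
  recipℕ n * ℕtoℚ n     ≡⟨ cong (recipℕ n *_) n≡0 ⟩
  recipℕ n * 0ℚ         ≡⟨ ℚP.*-zeroʳ (recipℕ n) ⟩
  0ℚ                    ∎)
  where open ≡-Reasoning

SqrtScaledEq-same-scale : ∀ {x y} d → .{{NonZero d}} → y ≡ 0ℚ ⊎ y ≡ 1ℚ → SqrtScaledEq x d y d → x ≡ y
SqrtScaledEq-same-scale {x} {y} d y∈01 (xxd≡yyd , 0≤xy) =
  square-root-of-0-or-1 y∈01 (*-cancelʳ-≡ {x * x} (ℕtoℚ-nonZero d) xxd≡yyd) 0≤xy

SqrtScaledEq-refl : ∀ {y} d → y ≡ 0ℚ ⊎ y ≡ 1ℚ → SqrtScaledEq y d y d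
SqrtScaledEq-refl d (inj₁ refl) = refl , ℚP.≤-refl
SqrtScaledEq-refl d (inj₂ refl) = refl , ℚP.nonNegative⁻¹ 1ℚ

sumFin≡sum : ∀ n (f : Fin n → ℚ) → sumFin n f ≡ sum f
sumFin≡sum zero    f = refl
sumFin≡sum (suc n) f = cong (f fzero +_) (sumFin≡sum n (λ i → f (fsuc i)))

[≟]ℚ-yes : ∀ {n} {a b : Fin n} → a ≡ b → [ a ≟ b ]ℚ ≡ 1ℚ
[≟]ℚ-yes a≡b rewrite ≡-≟-identity _≟_ a≡b = refl

[≟]ℚ-no : ∀ {n} {a b : Fin n} → a ≢ b → [ a ≟ b ]ℚ ≡ 0ℚ
[≟]ℚ-no a≢b rewrite ≢-≟-identity _≟_ a≢b = refl

[≟]ℚ-0-or-1 : ∀ {n} (a b : Fin n) → [ a ≟ b ]ℚ ≡ 0ℚ ⊎ [ a ≟ b ]ℚ ≡ 1ℚ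
[≟]ℚ-0-or-1 a b with a ≟ b
... | yes _ = inj₂ refl
... | no  _ = inj₁ refl

[≟]ℚ-suc : ∀ {n} (a b : Fin n) → [ fsuc a ≟ fsuc b ]ℚ ≡ [ a ≟ b ]ℚ
[≟]ℚ-suc a b = cong (if_then 1ℚ else 0ℚ) (⌊⌋-map′ _ _ (a ≟ b))

sum-δ : ∀ {n} (a : Fin n) (f : Fin n → ℚ) → sum (λ b → [ a ≟ b ]ℚ * f b) ≡ f a
sum-δ fzero    f = begin
  1ℚ * f fzero + sum (λ b → 0ℚ * f (fsuc b))  ≡⟨ cong₂ _+_ (ℚP.*-identityˡ (f fzero)) (sym (*-distribˡ-sum 0ℚ (λ b → f (fsuc b)))) ⟩
  f fzero + 0ℚ * sum (λ b → f (fsuc b))       ≡⟨ cong (f fzero +_) (ℚP.*-zeroˡ (sum (λ b → f (fsuc b)))) ⟩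
  f fzero + 0ℚ                                ≡⟨ ℚP.+-identityʳ (f fzero) ⟩
  f fzero                                     ∎
  where open ≡-Reasoning
sum-δ (fsuc a) f = begin
  0ℚ * f fzero + sum (λ b → [ fsuc a ≟ fsuc b ]ℚ * f (fsuc b))
    ≡⟨ cong₂ _+_ (ℚP.*-zeroˡ (f fzero)) (sum-cong-≗ (λ b → cong (_* f (fsuc b)) ([≟]ℚ-suc a b))) ⟩
  0ℚ + sum (λ b → [ a ≟ b ]ℚ * f (fsuc b))
    ≡⟨ ℚP.+-identityˡ _ ⟩
  sum (λ b → [ a ≟ b ]ℚ * f (fsuc b))
    ≡⟨ sum-δ a (λ b → f (fsuc b)) ⟩
  f (fsuc a) ∎
  where open ≡-Reasoning

fibreSize : ∀ {n m} → (Fin n → Fin m) → Fin m → ℕ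
fibreSize g w = ℕΣ.sum (λ a → if ⌊ g a ≟ w ⌋ then 1 else 0)

ℕΣ-sum-unique : (S : ∀ n → (Fin n → ℕ) → ℕ) →
  (∀ g → S zero g ≡ 0) → (∀ n g → S (suc n) g ≡ g fzero ℕ.+ S n (λ i → g (fsuc i))) →
  ∀ {n} (g : Fin n → ℕ) → S n g ≡ ℕΣ.sum g
ℕΣ-sum-unique S S-zero S-suc {zero}  g = S-zero g
ℕΣ-sum-unique S S-zero S-suc {suc n} g =
  trans (S-suc n g) (cong (g fzero ℕ.+_) (ℕΣ-sum-unique S S-zero S-suc (λ i → g (fsuc i))))

-- `deg` and `flen` sum with a function local to their definitions, which
-- cannot be named; Agda infers it as `degSum X w` (resp. `flenSum X f`) once
-- `nA` and the summand are abstracted to variables.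
mutual
  private
    degSum : (X : OrientableMap) → Fin (OrientableMap.nV X) → ∀ n → (Fin n → ℕ) → ℕ
    degSum X w = _

  deg≡fibreSize : ∀ X w → deg X w ≡ fibreSize (OrientableMap.tail X) w
  deg≡fibreSize X w with OrientableMap.nA X | OrientableMap.tail X
  ... | _ | tail with (λ a → if ⌊ tail a ≟ w ⌋ then 1 else 0)
  ... | indicator = ℕΣ-sum-unique (degSum X w) (λ _ → refl) (λ _ _ → refl) indicator

mutual
  private
    flenSum : (X : OrientableMap) → Fin (OrientableMap.nF X) → ∀ n → (Fin n → ℕ) → ℕ
    flenSum X f = _

  flen≡fibreSize : ∀ X f → flen X f ≡ fibreSize (OrientableMap.face X) f
  flen≡fibreSize X f with OrientableMap.nA X | OrientableMap.face X
  ... | _ | face with (λ a → if ⌊ face a ≟ f ⌋ then 1 else 0)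
  ... | indicator = ℕΣ-sum-unique (flenSum X f) (λ _ → refl) (λ _ _ → refl) indicator

ℕtoℚ-sum : ∀ {n} (g : Fin n → ℕ) → ℕtoℚ (ℕΣ.sum g) ≡ sum (λ a → ℕtoℚ (g a))
ℕtoℚ-sum {zero}  g = refl
ℕtoℚ-sum {suc n} g = trans (ℕtoℚ-homo-+ (g fzero) _) (cong (ℕtoℚ (g fzero) +_) (ℕtoℚ-sum (λ a → g (fsuc a))))

term≤sum : ∀ {n} (g : Fin n → ℕ) a → g a ℕ.≤ ℕΣ.sum g
term≤sum g fzero    = ℕP.m≤m+n (g fzero) _
term≤sum g (fsuc a) = ℕP.≤-trans (term≤sum (λ i → g (fsuc i)) a) (ℕP.m≤n+m _ (g fzero))

fibreSize-ℚ : ∀ {n m} (g : Fin n → Fin m) w → ℕtoℚ (fibreSize g w) ≡ sum (λ a → [ g a ≟ w ]ℚ)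
fibreSize-ℚ g w = trans (ℕtoℚ-sum (λ a → if ⌊ g a ≟ w ⌋ then 1 else 0)) (sum-cong-≗ (λ a → ℕtoℚ-indicator ⌊ g a ≟ w ⌋))
  where
  ℕtoℚ-indicator : ∀ b → ℕtoℚ (if b then 1 else 0) ≡ (if b then 1ℚ else 0ℚ)
  ℕtoℚ-indicator true  = refl
  ℕtoℚ-indicator false = refl

fibreSize-nonZero : ∀ {n m} (g : Fin n → Fin m) a → NonZero (fibreSize g (g a))
fibreSize-nonZero g a = ℕ.>-nonZero (ℕP.≤-trans 1≤indicator (term≤sum indicator a))
  where
  indicator : Fin _ → ℕ
  indicator b = if ⌊ g b ≟ g a ⌋ then 1 else 0
  1≤indicator : 1 ℕ.≤ indicator a
  1≤indicator rewrite ≡-≟-identity _≟_ (refl {x = g a}) = ℕP.≤-refl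

infixr 20 _·_

_·_ : ∀ {n} → Mat n → (Fin n → ℚ) → Fin n → ℚ
(M · f) a = sum (λ b → M a b * f b)

·-congʳ : ∀ {n} (M : Mat n) {f h : Fin n → ℚ} → f ≗ h → M · f ≗ M · h
·-congʳ M f≗h a = sum-cong-≗ (λ b → cong (M a b *_) (f≗h b))

·-congˡ : ∀ {n} {M N : Mat n} (f : Fin n → ℚ) → (∀ a b → M a b ≡ N a b) → M · f ≗ N · f
·-congˡ f M≡N a = sum-cong-≗ (λ b → cong (_* f b) (M≡N a b))

·-linear : ∀ {n} (M : Mat n) α β (f h : Fin n → ℚ) →
  M · (λ b → α * f b + β * h b) ≗ λ a → α * (M · f) a + β * (M · h) a
·-linear M α β f h a = begin
  sum (λ b → M a b * (α * f b + β * h b))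
    ≡⟨ sum-cong-≗ (λ b → solve 5 (λ m α β x y → m :* (α :* x :+ β :* y) := α :* (m :* x) :+ β :* (m :* y))
                                 refl (M a b) α β (f b) (h b)) ⟩
  sum (λ b → α * (M a b * f b) + β * (M a b * h b))
    ≡⟨ ∑-distrib-+ (λ b → α * (M a b * f b)) (λ b → β * (M a b * h b)) ⟩
  sum (λ b → α * (M a b * f b)) + sum (λ b → β * (M a b * h b))
    ≡⟨ sym (cong₂ _+_ (*-distribˡ-sum α (λ b → M a b * f b)) (*-distribˡ-sum β (λ b → M a b * h b))) ⟩
  α * (M · f) a + β * (M · h) a ∎
  where open ≡-Reasoning

⊗-· : ∀ {n} (A B : Mat n) (f : Fin n → ℚ) → (A ⊗ B) · f ≗ A · (B · f)
⊗-· {n} A B f a = begin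
  sum (λ b → sumFin n (λ k → A a k * B k b) * f b)
    ≡⟨ sum-cong-≗ (λ b → cong (_* f b) (sumFin≡sum n (λ k → A a k * B k b))) ⟩
  sum (λ b → sum (λ k → A a k * B k b) * f b)
    ≡⟨ sum-cong-≗ (λ b → *-distribʳ-sum (f b) (λ k → A a k * B k b)) ⟩
  sum (λ b → sum (λ k → A a k * B k b * f b))
    ≡⟨ ∑-comm (λ b k → A a k * B k b * f b) ⟩
  sum (λ k → sum (λ b → A a k * B k b * f b))
    ≡⟨ sum-cong-≗ (λ k → sum-cong-≗ (λ b → ℚP.*-assoc (A a k) (B k b) (f b))) ⟩
  sum (λ k → sum (λ b → A a k * (B k b * f b)))
    ≡⟨ sum-cong-≗ (λ k → sym (*-distribˡ-sum (A a k) (λ b → B k b * f b))) ⟩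
  (A · (B · f)) a ∎
  where open ≡-Reasoning

idM-· : ∀ {n} (f : Fin n → ℚ) → idM · f ≗ f
idM-· f a = sum-δ a f

reflect : ∀ {n} → Mat n → (Fin n → ℚ) → Fin n → ℚ
reflect A f a = ℕtoℚ 2 * (A · f) a - f a

reflect-congʳ : ∀ {n} (A : Mat n) {f h : Fin n → ℚ} → f ≗ h → reflect A f ≗ reflect A h
reflect-congʳ A f≗h a = cong₂ (λ x y → ℕtoℚ 2 * x - y) (·-congʳ A f≗h a) (f≗h a)

twoMinusI-· : ∀ X (A : Mat (OrientableMap.nA X)) f → twoMinusI X A · f ≗ reflect A f
twoMinusI-· X A f a = begin
  sum (λ b → (ℕtoℚ 2 * A a b - idM a b) * f b)
    ≡⟨ sum-cong-≗ (λ b → solve 4 (λ t m i x → (t :* m :- i) :* x := t :* (m :* x) :+ (:- con 1ℚ) :* (i :* x))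
                                 refl (ℕtoℚ 2) (A a b) (idM a b) (f b)) ⟩
  sum (λ b → ℕtoℚ 2 * (A a b * f b) + - 1ℚ * (idM a b * f b))
    ≡⟨ ∑-distrib-+ (λ b → ℕtoℚ 2 * (A a b * f b)) (λ b → - 1ℚ * (idM a b * f b)) ⟩
  sum (λ b → ℕtoℚ 2 * (A a b * f b)) + sum (λ b → - 1ℚ * (idM a b * f b))
    ≡⟨ sym (cong₂ _+_ (*-distribˡ-sum (ℕtoℚ 2) (λ b → A a b * f b)) (*-distribˡ-sum (- 1ℚ) (λ b → idM a b * f b))) ⟩
  ℕtoℚ 2 * (A · f) a + - 1ℚ * (idM · f) a
    ≡⟨ cong (λ x → ℕtoℚ 2 * (A · f) a + - 1ℚ * x) (idM-· f a) ⟩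
  ℕtoℚ 2 * (A · f) a + - 1ℚ * f a
    ≡⟨ solve 2 (λ x y → x :+ (:- con 1ℚ) :* y := x :- y) refl (ℕtoℚ 2 * (A · f) a) (f a) ⟩
  reflect A f a ∎
  where open ≡-Reasoning

·-reflect : ∀ {n} (A B : Mat n) f → A · reflect B f ≗ λ a → ℕtoℚ 2 * (A · B · f) a - (A · f) a
·-reflect A B f a = begin
  (A · reflect B f) a
    ≡⟨ ·-congʳ A (λ b → solve 2 (λ x y → con (ℕtoℚ 2) :* x :- y := con (ℕtoℚ 2) :* x :+ (:- con 1ℚ) :* y)
                                refl ((B · f) b) (f b)) a ⟩
  (A · (λ b → ℕtoℚ 2 * (B · f) b + - 1ℚ * f b)) a
    ≡⟨ ·-linear A (ℕtoℚ 2) (- 1ℚ) (B · f) f a ⟩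
  ℕtoℚ 2 * (A · B · f) a + - 1ℚ * (A · f) a
    ≡⟨ solve 2 (λ x y → x :+ (:- con 1ℚ) :* y := x :- y) refl (ℕtoℚ 2 * (A · B · f) a) ((A · f) a) ⟩
  ℕtoℚ 2 * (A · B · f) a - (A · f) a ∎
  where open ≡-Reasoning

reflect-involutive : ∀ {n} (A : Mat n) → (∀ f → A · A · f ≗ A · f) → ∀ f → reflect A (reflect A f) ≗ f
reflect-involutive A idempotent f a = begin
  ℕtoℚ 2 * (A · reflect A f) a - reflect A f a
    ≡⟨ cong (λ x → ℕtoℚ 2 * x - reflect A f a) (·-reflect A A f a) ⟩
  ℕtoℚ 2 * (ℕtoℚ 2 * (A · A · f) a - (A · f) a) - (ℕtoℚ 2 * (A · f) a - f a)
    ≡⟨ cong (λ x → ℕtoℚ 2 * (ℕtoℚ 2 * x - (A · f) a) - (ℕtoℚ 2 * (A · f) a - f a)) (idempotent f a) ⟩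
  ℕtoℚ 2 * (ℕtoℚ 2 * (A · f) a - (A · f) a) - (ℕtoℚ 2 * (A · f) a - f a)
    ≡⟨ solve 2 (λ p x → con (ℕtoℚ 2) :* (con (ℕtoℚ 2) :* p :- p) :- (con (ℕtoℚ 2) :* p :- x) := x)
             refl ((A · f) a) (f a) ⟩
  f a ∎
  where open ≡-Reasoning

reflect-fixes : ∀ {n} (A : Mat n) {f} → A · f ≗ f → reflect A f ≗ f
reflect-fixes A {f} Af≗f a = trans (cong (λ x → ℕtoℚ 2 * x - f a) (Af≗f a))
  (solve 1 (λ x → con (ℕtoℚ 2) :* x :- x := x) refl (f a))

fixed-by-reflect : ∀ {n} (A : Mat n) {f} → reflect A f ≗ f → A · f ≗ f
fixed-by-reflect A {f} Rf≗f a = *-cancelˡ-≡ 2≢0 (begin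
  ℕtoℚ 2 * (A · f) a                       ≡⟨ solve 2 (λ p x → con (ℕtoℚ 2) :* p := (con (ℕtoℚ 2) :* p :- x) :+ x) refl ((A · f) a) (f a) ⟩
  ℕtoℚ 2 * (A · f) a - f a + f a           ≡⟨ cong (_+ f a) (Rf≗f a) ⟩
  f a + f a                                ≡⟨ solve 1 (λ x → x :+ x := con (ℕtoℚ 2) :* x) refl (f a) ⟩
  ℕtoℚ 2 * f a                             ∎)
  where open ≡-Reasoning

module Averaging {n m} (g : Fin n → Fin m) (size : Fin m → ℕ) (size≗ : size ≗ fibreSize g) where

  avg : Mat n
  avg a b = if ⌊ g a ≟ g b ⌋ then recipℕ (size (g a)) else 0ℚ

  avg-sym : ∀ a b → avg a b ≡ avg b a
  avg-sym a b with g a ≟ g b | g b ≟ g a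
  ... | yes ga≡gb | yes _     = cong (λ w → recipℕ (size w)) ga≡gb
  ... | no  _     | no  _     = refl
  ... | yes ga≡gb | no  gb≢ga = ⊥-elim (gb≢ga (sym ga≡gb))
  ... | no  ga≢gb | yes gb≡ga = ⊥-elim (ga≢gb (sym gb≡ga))

  avg-rowSum : ∀ a → sum (avg a) ≡ 1ℚ
  avg-rowSum a = begin
    sum (avg a)                                      ≡⟨ sum-cong-≗ entry ⟩
    sum (λ b → recipℕ (size (g a)) * [ g b ≟ g a ]ℚ)  ≡⟨ sym (*-distribˡ-sum (recipℕ (size (g a))) (λ b → [ g b ≟ g a ]ℚ)) ⟩
    recipℕ (size (g a)) * sum (λ b → [ g b ≟ g a ]ℚ)  ≡⟨ cong (recipℕ (size (g a)) *_) (sym count) ⟩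
    recipℕ (size (g a)) * ℕtoℚ (size (g a))          ≡⟨ recipℕ-inverseˡ (size (g a)) ⟩
    1ℚ                                               ∎
    where
    open ≡-Reasoning
    instance _ = subst NonZero (sym (size≗ (g a))) (fibreSize-nonZero g a)
    count : ℕtoℚ (size (g a)) ≡ sum (λ b → [ g b ≟ g a ]ℚ)
    count = trans (cong ℕtoℚ (size≗ (g a))) (fibreSize-ℚ g (g a))
    entry : ∀ b → avg a b ≡ recipℕ (size (g a)) * [ g b ≟ g a ]ℚ
    entry b with g a ≟ g b | g b ≟ g a
    ... | yes _     | yes _     = sym (ℚP.*-identityʳ (recipℕ (size (g a))))
    ... | no  _     | no  _     = sym (ℚP.*-zeroʳ (recipℕ (size (g a))))
    ... | yes ga≡gb | no  gb≢ga = ⊥-elim (gb≢ga (sym ga≡gb))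
    ... | no  ga≢gb | yes gb≡ga = ⊥-elim (ga≢gb (sym gb≡ga))

  ·-respects : ∀ f → (avg · f) Preserves (_≡_ on g) ⟶ _≡_
  ·-respects f ga≡ga′ = cong (λ w → sum (λ b → (if ⌊ w ≟ g b ⌋ then recipℕ (size w) else 0ℚ) * f b)) ga≡ga′

  ·-fixes : ∀ {f} → f Preserves (_≡_ on g) ⟶ _≡_ → avg · f ≗ f
  ·-fixes {f} f-respects a = begin
    sum (λ b → avg a b * f b)   ≡⟨ sum-cong-≗ entry ⟩
    sum (λ b → avg a b * f a)   ≡⟨ sym (*-distribʳ-sum (f a) (avg a)) ⟩
    sum (avg a) * f a           ≡⟨ cong (_* f a) (avg-rowSum a) ⟩
    1ℚ * f a                    ≡⟨ ℚP.*-identityˡ (f a) ⟩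
    f a                         ∎
    where
    open ≡-Reasoning
    entry : ∀ b → avg a b * f b ≡ avg a b * f a
    entry b with g a ≟ g b
    ... | yes ga≡gb = cong (recipℕ (size (g a)) *_) (f-respects (sym ga≡gb))
    ... | no  _     = trans (ℚP.*-zeroˡ (f b)) (sym (ℚP.*-zeroˡ (f a)))

  fixed⇒respects : ∀ {f} → avg · f ≗ f → f Preserves (_≡_ on g) ⟶ _≡_
  fixed⇒respects {f} Af≗f {a} {b} ga≡gb = trans (sym (Af≗f a)) (trans (·-respects f ga≡gb) (Af≗f b))

  ·-idempotent : ∀ f → avg · avg · f ≗ avg · f
  ·-idempotent f = ·-fixes (·-respects f)

  sum-· : ∀ f → sum (avg · f) ≡ sum f
  sum-· f = begin
    sum (λ a → sum (λ b → avg a b * f b))   ≡⟨ ∑-comm (λ a b → avg a b * f b) ⟩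
    sum (λ b → sum (λ a → avg a b * f b))   ≡⟨ sum-cong-≗ (λ b → sym (*-distribʳ-sum (f b) (λ a → avg a b))) ⟩
    sum (λ b → sum (λ a → avg a b) * f b)   ≡⟨ sum-cong-≗ (λ b → cong (_* f b) column) ⟩
    sum (λ b → 1ℚ * f b)                    ≡⟨ sum-cong-≗ (λ b → ℚP.*-identityˡ (f b)) ⟩
    sum f                                   ∎
    where
    open ≡-Reasoning
    column : ∀ {b} → sum (λ a → avg a b) ≡ 1ℚ
    column {b} = trans (sum-cong-≗ (λ a → avg-sym a b)) (avg-rowSum b)

[≟]ℚ-sum≡1⇒either : ∀ {n} {t u v : Fin n} → [ t ≟ u ]ℚ + [ t ≟ v ]ℚ ≡ 1ℚ → t ≡ u ⊎ t ≡ v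
[≟]ℚ-sum≡1⇒either {t = t} {u} {v} sum≡1 with t ≟ u | t ≟ v
... | yes t≡u | _       = inj₁ t≡u
... | no  _   | yes t≡v = inj₂ t≡v
... | no  _   | no  _   = ⊥-elim (ℚP.1≢0 (sym sum≡1))

either⇒[≟]ℚ-sum≡1 : ∀ {n} {t u v : Fin n} → u ≢ v → t ≡ u ⊎ t ≡ v → [ t ≟ u ]ℚ + [ t ≟ v ]ℚ ≡ 1ℚ
either⇒[≟]ℚ-sum≡1 {t = t} u≢v (inj₁ refl) = cong₂ _+_ ([≟]ℚ-yes {a = t} refl) ([≟]ℚ-no u≢v)
either⇒[≟]ℚ-sum≡1 {t = t} u≢v (inj₂ refl) = cong₂ _+_ ([≟]ℚ-no (u≢v ∘ sym)) ([≟]ℚ-yes {a = t} refl)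

module _ (X : OrientableMap) where
  open OrientableMap X

  private
    module Q = Averaging tail (deg X) (deg≡fibreSize X)
    module P = Averaging face (flen X) (flen≡fibreSize X)

  constant-on-arcs : ∀ {f : Fin nA → ℚ} →
    f Preserves (_≡_ on tail) ⟶ _≡_ → f Preserves (_≡_ on face) ⟶ _≡_ → ∀ a b → f a ≡ f b
  constant-on-arcs {f} f-tail f-face a b = along (connected a b)
    where
    along : ∀ {b} → Reach σ θ a b → f a ≡ f b
    along here = refl
    along (stepσ {b} r) = trans (along r) (f-tail (tail-orbit₂ b (σ b) (1 , refl)))
    along (stepθ {b} r) = trans (along r) (trans (f-face (face-orbit₂ b (σ (θ b)) (1 , refl)))
                                                 (f-tail (sym (tail-orbit₂ (θ b) (σ (θ b)) (1 , refl)))))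

  deg-nonZero : ∀ w → NonZero (deg X w)
  deg-nonZero w with tail-surj w
  ... | a , refl = subst NonZero (sym (deg≡fibreSize X (tail a))) (fibreSize-nonZero tail a)

  sum-Ne : ∀ w → sum (Ne X w) ≡ ℕtoℚ (deg X w)
  sum-Ne w = sym (trans (cong ℕtoℚ (deg≡fibreSize X w)) (fibreSize-ℚ tail w))

  Qm-fixes-Ne : ∀ w → Qm X · Ne X w ≗ Ne X w
  Qm-fixes-Ne w = Q.·-fixes (cong (λ t → [ t ≟ w ]ℚ))

  U-· : ∀ f → U X · f ≗ reflect (Pm X) (reflect (Qm X) f)
  U-· f a = begin
    (U X · f) a                                          ≡⟨ ⊗-· (twoMinusI X (Pm X)) (twoMinusI X (Qm X)) f a ⟩
    (twoMinusI X (Pm X) · twoMinusI X (Qm X) · f) a       ≡⟨ ·-congʳ (twoMinusI X (Pm X)) (twoMinusI-· X (Qm X) f) a ⟩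
    (twoMinusI X (Pm X) · reflect (Qm X) f) a            ≡⟨ twoMinusI-· X (Pm X) (reflect (Qm X) f) a ⟩
    reflect (Pm X) (reflect (Qm X) f) a                  ∎
    where open ≡-Reasoning

  U-·-Qm-fixed : ∀ {f} → Qm X · f ≗ f → U X · f ≗ reflect (Pm X) f
  U-·-Qm-fixed {f} Qf≗f a = trans (U-· f a) (reflect-congʳ (Pm X) (reflect-fixes (Qm X) Qf≗f) a)

  UτNe-one : ∀ u → UτNe X 1 u ≗ U X · Ne X u
  UτNe-one u a = begin
    sumFin nA (λ b → (U X ⊗ idM) a b * Ne X u b)   ≡⟨ sumFin≡sum nA (λ b → (U X ⊗ idM) a b * Ne X u b) ⟩
    ((U X ⊗ idM) · Ne X u) a                       ≡⟨ ⊗-· (U X) idM (Ne X u) a ⟩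
    (U X · idM · Ne X u) a                         ≡⟨ ·-congʳ (U X) (idM-· (Ne X u)) a ⟩
    (U X · Ne X u) a                               ∎
    where open ≡-Reasoning

  PST-one⇒U·Ne : ∀ {u v} → deg X u ≡ deg X v → PST X 1 u v → U X · Ne X u ≗ Ne X v
  PST-one⇒U·Ne {u} {v} du≡dv pst a =
    trans (sym (UτNe-one u a))
      (SqrtScaledEq-same-scale (deg X u) ([≟]ℚ-0-or-1 (tail a) v)
        (subst (SqrtScaledEq (UτNe X 1 u a) (deg X u) (Ne X v a)) (sym du≡dv) (pst a)))
    where instance _ = deg-nonZero u

  U·Ne⇒PST-one : ∀ {u v} → deg X u ≡ deg X v → U X · Ne X u ≗ Ne X v → PST X 1 u v
  U·Ne⇒PST-one {u} {v} du≡dv U·Neu≗Nev a =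
    subst₂ (λ x d → SqrtScaledEq x (deg X u) (Ne X v a) d)
      (sym (trans (UτNe-one u a) (U·Neu≗Nev a))) du≡dv
      (SqrtScaledEq-refl (deg X u) ([≟]ℚ-0-or-1 (tail a) v))

  PST-one⇒two-vertices : ∀ {u v} → u ≢ v → deg X u ≡ deg X v → PST X 1 u v → ∀ w → w ≡ u ⊎ w ≡ v
  PST-one⇒two-vertices {u} {v} u≢v du≡dv pst w with tail-surj w | tail-surj u
  ... | a , refl | a₀ , refl = [≟]ℚ-sum≡1⇒either (begin
    s a    ≡⟨ constant-on-arcs s-tail s-face a a₀ ⟩
    s a₀   ≡⟨ either⇒[≟]ℚ-sum≡1 u≢v (inj₁ refl) ⟩
    1ℚ     ∎)
    where
    open ≡-Reasoning
    s : Fin nA → ℚ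
    s b = Ne X u b + Ne X v b
    s-tail : s Preserves (_≡_ on tail) ⟶ _≡_
    s-tail = cong (λ t → [ t ≟ u ]ℚ + [ t ≟ v ]ℚ)
    s≡2P·Ne : ∀ b → s b ≡ ℕtoℚ 2 * (Pm X · Ne X u) b
    s≡2P·Ne b = begin
      Ne X u b + Ne X v b                                   ≡⟨ cong (Ne X u b +_) (sym (PST-one⇒U·Ne du≡dv pst b)) ⟩
      Ne X u b + (U X · Ne X u) b                           ≡⟨ cong (Ne X u b +_) (U-·-Qm-fixed (Qm-fixes-Ne u) b) ⟩
      Ne X u b + (ℕtoℚ 2 * (Pm X · Ne X u) b - Ne X u b)     ≡⟨ solve 2 (λ x p → x :+ (con (ℕtoℚ 2) :* p :- x) := con (ℕtoℚ 2) :* p)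
                                                                      refl (Ne X u b) ((Pm X · Ne X u) b) ⟩
      ℕtoℚ 2 * (Pm X · Ne X u) b                            ∎
    s-face : s Preserves (_≡_ on face) ⟶ _≡_
    s-face {b} {b′} fb≡fb′ = trans (s≡2P·Ne b)
      (trans (cong (ℕtoℚ 2 *_) (P.·-respects (Ne X u) fb≡fb′)) (sym (s≡2P·Ne b′)))

  U²≡I⇒U·U· : (∀ a b → (U X ⊗ U X) a b ≡ idM a b) → ∀ f → U X · U X · f ≗ f
  U²≡I⇒U·U· U²≡I f a = begin
    (U X · U X · f) a     ≡⟨ sym (⊗-· (U X) (U X) f a) ⟩
    ((U X ⊗ U X) · f) a   ≡⟨ ·-congˡ f U²≡I a ⟩
    (idM · f) a           ≡⟨ idM-· f a ⟩
    f a                   ∎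
    where open ≡-Reasoning

  -- As reflections are involutions, U (U f) = f with U f = reflect P f forces
  -- reflect Q (reflect P f) = reflect P f; and P f is the mean of reflect P f
  -- and f, both fixed by Q.
  P·-respects-tail : ∀ {f} → U X · U X · f ≗ f → Qm X · f ≗ f → (Pm X · f) Preserves (_≡_ on tail) ⟶ _≡_
  P·-respects-tail {f} U²f≗f Qf≗f {a} {b} ta≡tb = *-cancelˡ-≡ 2≢0 (begin
    ℕtoℚ 2 * p a   ≡⟨ split a ⟩
    g a + f a      ≡⟨ cong₂ _+_ (Q.fixed⇒respects (fixed-by-reflect (Qm X) RQg≗g) ta≡tb) (Q.fixed⇒respects Qf≗f ta≡tb) ⟩
    g b + f b      ≡⟨ sym (split b) ⟩
    ℕtoℚ 2 * p b   ∎)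
    where
    open ≡-Reasoning
    p = Pm X · f
    g = reflect (Pm X) f
    split : ∀ c → ℕtoℚ 2 * p c ≡ g c + f c
    split c = solve 2 (λ p x → con (ℕtoℚ 2) :* p := (con (ℕtoℚ 2) :* p :- x) :+ x) refl (p c) (f c)
    RPRQg≗f : reflect (Pm X) (reflect (Qm X) g) ≗ f
    RPRQg≗f c = begin
      reflect (Pm X) (reflect (Qm X) g) c             ≡⟨ reflect-congʳ (Pm X) (reflect-congʳ (Qm X) (sym ∘ U-·-Qm-fixed Qf≗f)) c ⟩
      reflect (Pm X) (reflect (Qm X) (U X · f)) c     ≡⟨ sym (U-· (U X · f) c) ⟩
      (U X · U X · f) c                               ≡⟨ U²f≗f c ⟩
      f c                                             ∎
    RQg≗g : reflect (Qm X) g ≗ g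
    RQg≗g c = trans (sym (reflect-involutive (Pm X) P.·-idempotent (reflect (Qm X) g) c))
                    (reflect-congʳ (Pm X) RPRQg≗f c)

  two-vertices⇒PST-one : (∀ a b → (U X ⊗ U X) a b ≡ idM a b) → ∀ {u v} → u ≢ v → deg X u ≡ deg X v →
    (∀ w → w ≡ u ⊎ w ≡ v) → PST X 1 u v
  two-vertices⇒PST-one U²≡I {u} {v} u≢v du≡dv two-vertices = U·Ne⇒PST-one du≡dv (λ a → begin
    (U X · Ne X u) a                   ≡⟨ U-·-Qm-fixed (Qm-fixes-Ne u) a ⟩
    ℕtoℚ 2 * p a - Ne X u a            ≡⟨ cong (_- Ne X u a) (2p≡1 a) ⟩
    1ℚ - Ne X u a                      ≡⟨ cong (_- Ne X u a) (sym (Ne-sum a)) ⟩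
    Ne X u a + Ne X v a - Ne X u a     ≡⟨ solve 2 (λ x y → x :+ y :- x := y) refl (Ne X u a) (Ne X v a) ⟩
    Ne X v a                           ∎)
    where
    open ≡-Reasoning
    instance _ = deg-nonZero u
    p = Pm X · Ne X u
    D = ℕtoℚ (deg X u)
    Ne-sum : ∀ a → Ne X u a + Ne X v a ≡ 1ℚ
    Ne-sum a = either⇒[≟]ℚ-sum≡1 u≢v (two-vertices (tail a))
    p-constant : ∀ a b → p a ≡ p b
    p-constant = constant-on-arcs (P·-respects-tail (U²≡I⇒U·U· U²≡I (Ne X u)) (Qm-fixes-Ne u))
                                  (P.·-respects (Ne X u))
    2p≡1 : ∀ a → ℕtoℚ 2 * p a ≡ 1ℚ
    2p≡1 a = *-cancelʳ-≡ {ℕtoℚ 2 * p a} (ℕtoℚ-nonZero (deg X u)) (begin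
      ℕtoℚ 2 * p a * D                       ≡⟨ solve 2 (λ p D → con (ℕtoℚ 2) :* p :* D := p :* (D :+ D)) refl (p a) D ⟩
      p a * (D + D)                          ≡⟨ cong (p a *_) (cong₂ _+_ (sym (sum-Ne u)) (trans (cong ℕtoℚ du≡dv) (sym (sum-Ne v)))) ⟩
      p a * (sum (Ne X u) + sum (Ne X v))    ≡⟨ cong (p a *_) (sym (∑-distrib-+ (Ne X u) (Ne X v))) ⟩
      p a * sum (λ b → Ne X u b + Ne X v b)  ≡⟨ cong (p a *_) (sum-cong-≗ Ne-sum) ⟩
      p a * sum (λ (_ : Fin nA) → 1ℚ)        ≡⟨ *-distribˡ-sum (p a) (λ (_ : Fin nA) → 1ℚ) ⟩
      sum (λ (_ : Fin nA) → p a * 1ℚ)        ≡⟨ sum-cong-≗ (λ b → trans (ℚP.*-identityʳ (p a)) (p-constant a b)) ⟩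
      sum p                                  ≡⟨ P.sum-· (Ne X u) ⟩
      sum (Ne X u)                           ≡⟨ sum-Ne u ⟩
      D                                      ≡⟨ sym (ℚP.*-identityˡ D) ⟩
      1ℚ * D                                 ∎)

proposition6p4 : (X : OrientableMap) →
    (∀ a b → (U X ⊗ U X) a b ≡ idM a b) →
    (u v : Fin (OrientableMap.nV X)) → ¬ (u ≡ v) → deg X u ≡ deg X v →
    (PST X 1 u v → ∀ w → w ≡ u ⊎ w ≡ v) × ((∀ w → w ≡ u ⊎ w ≡ v) → PST X 1 u v)
proposition6p4 X U²≡I u v u≢v du≡dv =
  PST-one⇒two-vertices X u≢v du≡dv , two-vertices⇒PST-one X U²≡I u≢v du≡dv
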